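{- Let $O$ and $O'$ be OMQA$[\mathsf{UCQ}]$-ontologies that both admit query constructivity. If $O|_{\mathsf{CQ}}=O'|_{\mathsf{CQ}}$, then $O=O'$.
   Context: Terms are constants (set $\Delta$), labeled nulls, or variables; a database is a finite set of variable- and null-free relational atoms; $adom(D)$ its constants. A Boolean UCQ is a sentence built from relational atoms (constants allowed) using only $\wedge,\vee,\exists$; a BCQ is one of the form $\exists\mathbf y\,\varphi$ with $\varphi$ a nonempty conjunction of relational atoms; $\mathsf{CQ}$ is the class of BCQs; $const(q)$ the constants of $q$. For disjoint schemas $\mathscr D,\mathscr Q$, an OMQA$[\mathsf{UCQ}]$-ontology over $(\mathscr D,\mathscr Q)$ is a set $O$ of pairs $(D,q)$, $D$ a nonempty $\mathscr D$-database, $q$ a Boolean $\mathscr Q$-UCQ with $const(q)\subseteq adom(D)$, such that: $(D,p),(D,q)\in O\Rightarrow(D,p\wedge q)\in O$; $q\vDash p$ ($p$ a Boolean UCQ) and $(D,q)\in O\Rightarrow(D,p)\in O$; if $(D,q)\in O$ and an injective map on $adom(D)$ fixing $const(q)$ maps $D$ into a database $D'$ then $(D',q)\in O$; if $(D,q)\in O$ and $\tau$ is a partial injective map $\Delta\to\Delta$ then $(\tau(D),\tau(q))\in O$. $O$ admits query constructivity if $(D,p\vee q)\in O$ implies $(D,p)\in O$ or $(D,q)\in O$. $O|_{\mathsf{CQ}}=\{(D,q)\in O: q\in\mathsf{CQ}\}$. -}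

module Defs where

open import Data.Nat using (ℕ; suc)
open import Data.Fin using (Fin)
open import Data.Vec using (Vec; []; _∷_; lookup)
import Data.Vec as Vec
open import Data.List using (List; [])
import Data.List as List
open import Data.List.Membership.Propositional using (_∈_)
import Data.Vec.Membership.Propositional as V
open import Data.Product using (Σ; _×_; _,_)
open import Data.Sum using (_⊎_)
open import Relation.Binary.PropositionalEquality using (_≡_)
open import Relation.Nullary using (¬_)

-- Constants: the countably infinite set Δ is modelled by ℕ.

Const : Set
Const = ℕ

-- Schemas: finitely many relation symbols, each with an arity.
-- Two distinct Schema values have (by construction) disjoint symbol types.

record Schema : Set where
  field
    size  : ℕ
    arity : Fin size → ℕ

Sym : Schema → Set
Sym S = Fin (Schema.size S)

record GAtom (S : Schema) : Set where
  constructor _⟨_⟩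
  field
    rel  : Sym S
    args : Vec Const (Schema.arity S rel)

Database : Schema → Set
Database S = List (GAtom S)

NonEmptyDB : {S : Schema} → Database S → Set
NonEmptyDB D = ¬ (D ≡ [])

_∈adom_ : {S : Schema} → Const → Database S → Set
_∈adom_ {S} c D = Σ (GAtom S) λ α → (α ∈ D) × (c V.∈ GAtom.args α)

mapAtom : {S : Schema} → (Const → Const) → GAtom S → GAtom S
mapAtom h (R ⟨ as ⟩) = R ⟨ Vec.map h as ⟩

mapDB : {S : Schema} → (Const → Const) → Database S → Database S
mapDB h D = List.map (mapAtom h) D

InjectiveOnAdom : {S : Schema} → (Const → Const) → Database S → Set
InjectiveOnAdom h D = ∀ a b → a ∈adom D → b ∈adom D → h a ≡ h b → a ≡ b

-- UCQ formulas: built from relational atoms (constants allowed) with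
-- ∧, ∨, ∃.  Variables are de Bruijn indices; UCQF S n has n free
-- variables, so Boolean UCQs (sentences) are UCQF S 0.

data Term (n : ℕ) : Set where
  cst : Const → Term n
  var : Fin n → Term n

infixr 6 _∧_
infixr 5 _∨_

data UCQF (S : Schema) : ℕ → Set where
  atom : ∀ {n} (R : Sym S) → Vec (Term n) (Schema.arity S R) → UCQF S n
  _∧_  : ∀ {n} → UCQF S n → UCQF S n → UCQF S n
  _∨_  : ∀ {n} → UCQF S n → UCQF S n → UCQF S n
  ∃'   : ∀ {n} → UCQF S (suc n) → UCQF S n

BUCQ : Schema → Set
BUCQ S = UCQF S 0

data _occursIn_ {S : Schema} (c : Const) : ∀ {n} → UCQF S n → Set where
  inAtom : ∀ {n R} {ts : Vec (Term n) (Schema.arity S R)} →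
           cst c V.∈ ts → c occursIn atom R ts
  in∧ˡ : ∀ {n} {φ ψ : UCQF S n} → c occursIn φ → c occursIn (φ ∧ ψ)
  in∧ʳ : ∀ {n} {φ ψ : UCQF S n} → c occursIn ψ → c occursIn (φ ∧ ψ)
  in∨ˡ : ∀ {n} {φ ψ : UCQF S n} → c occursIn φ → c occursIn (φ ∨ ψ)
  in∨ʳ : ∀ {n} {φ ψ : UCQF S n} → c occursIn ψ → c occursIn (φ ∨ ψ)
  in∃  : ∀ {n} {φ : UCQF S (suc n)} → c occursIn φ → c occursIn (∃' φ)

ConstsIn : {S S' : Schema} → BUCQ S → Database S' → Set
ConstsIn q D = ∀ c → c occursIn q → c ∈adom D

mapTerm : ∀ {n} → (Const → Const) → Term n → Term n
mapTerm h (cst c) = cst (h c)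
mapTerm h (var x) = var x

mapQ : ∀ {S n} → (Const → Const) → UCQF S n → UCQF S n
mapQ h (atom R ts) = atom R (Vec.map (mapTerm h) ts)
mapQ h (φ ∧ ψ) = mapQ h φ ∧ mapQ h ψ
mapQ h (φ ∨ ψ) = mapQ h φ ∨ mapQ h ψ
mapQ h (∃' φ) = ∃' (mapQ h φ)

data IsConj {S : Schema} {n : ℕ} : UCQF S n → Set where
  atom : ∀ R ts → IsConj (atom R ts)
  _∧_  : ∀ {φ ψ} → IsConj φ → IsConj ψ → IsConj (φ ∧ ψ)

data IsCQ' {S : Schema} : ∀ {n} → UCQF S n → Set where
  body : ∀ {n} {φ : UCQF S n} → IsConj φ → IsCQ' φ
  ex   : ∀ {n} {φ : UCQF S (suc n)} → IsCQ' φ → IsCQ' (∃' φ)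

IsCQ : {S : Schema} → BUCQ S → Set
IsCQ q = IsCQ' q

record Interp (S : Schema) : Set₁ where
  field
    dom : Set
    ι   : Const → dom
    ext : (R : Sym S) → Vec dom (Schema.arity S R) → Set

module _ {S : Schema} (I : Interp S) where
  open Interp I

  evalT : ∀ {n} → Vec dom n → Term n → dom
  evalT env (cst c) = ι c
  evalT env (var x) = lookup env x

  Sat : ∀ {n} → UCQF S n → Vec dom n → Set
  Sat (atom R ts) env = ext R (Vec.map (evalT env) ts)
  Sat (φ ∧ ψ) env = Sat φ env × Sat ψ env
  Sat (φ ∨ ψ) env = Sat φ env ⊎ Sat ψ env
  Sat (∃' φ) env = Σ dom λ a → Sat φ (a ∷ env)

_⊨_ : {S : Schema} → BUCQ S → BUCQ S → Set₁
_⊨_ {S} q p = (I : Interp S) → Sat I q [] → Sat I p []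

-- OMQA[UCQ]-ontologies over (𝒟, 𝒬): sets of pairs (D, q).

OntRel : Schema → Schema → Set₁
OntRel 𝒟 𝒬 = Database 𝒟 → BUCQ 𝒬 → Set

record IsOntology (𝒟 𝒬 : Schema) (O : OntRel 𝒟 𝒬) : Set₁ where
  field
    wf : ∀ D q → O D q → NonEmptyDB D × ConstsIn q D
    conj : ∀ D p q → O D p → O D q → O D (p ∧ q)
    entail : ∀ D q p → q ⊨ p → ConstsIn p D → O D q → O D p
    hom : ∀ D D' q (h : Const → Const) →
          InjectiveOnAdom h D →
          (∀ c → c occursIn q → h c ≡ c) →
          (∀ α → α ∈ D → mapAtom h α ∈ D') →
          O D q → O D' q
    ren : ∀ D q (τ : Const → Const) →
          InjectiveOnAdom τ D →
          O D q → O (mapDB τ D) (mapQ τ q)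

QueryConstructive : {𝒟 𝒬 : Schema} → OntRel 𝒟 𝒬 → Set
QueryConstructive O = ∀ D p q → O D (p ∨ q) → O D p ⊎ O D q

SameCQRestriction : {𝒟 𝒬 : Schema} → OntRel 𝒟 𝒬 → OntRel 𝒟 𝒬 → Set
SameCQRestriction O O' =
  ∀ D q → IsCQ q → ((O D q → O' D q) × (O' D q → O D q))

SameOntology : {𝒟 𝒬 : Schema} → OntRel 𝒟 𝒬 → OntRel 𝒟 𝒬 → Set
SameOntology O O' = ∀ D q → ((O D q → O' D q) × (O' D q → O D q))

-- Every Boolean UCQ q is equivalent to a finite disjunction of CQs whose
-- constants occur in q (its disjunctive prenex normal form). If O contains
-- (D, q), it contains (D, ⋁ disjuncts) by closure under entailment, hence
-- (D, c) for one disjunct c by query constructivity. As c is a CQ, (D, c)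
-- lies in O', and c ⊨ q puts (D, q) in O'.
module Submission where

open import Defs
open import Data.Nat using (ℕ; suc)
open import Data.Fin using (Fin; zero; suc; lift)
open import Data.Vec using (Vec; _∷_; lookup)
import Data.Vec as Vec
import Data.Vec.Properties as Vec
import Data.Vec.Relation.Unary.Any as VecAny
import Data.Vec.Relation.Unary.Any.Properties as VecAny
open import Data.List using (List; []; _∷_; [_]; _++_; map; foldr; cartesianProductWith)
open import Data.List.Membership.Propositional using (_∈_)
open import Data.List.Membership.Propositional.Properties
  using (∈-map⁺; ∈-map⁻; ∈-++⁺ˡ; ∈-++⁺ʳ; ∈-++⁻; ∈-cartesianProductWith⁺; ∈-cartesianProductWith⁻)
open import Data.List.Relation.Unary.Any using (here; there)
open import Data.Product using (Σ; ∃; _×_; _,_; proj₁; proj₂)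
open import Data.Sum using (_⊎_; inj₁; inj₂; [_,_]′)
open import Function using (_∘_)
open import Function.Bundles using (_⇔_; mk⇔; Equivalence)
open import Relation.Binary.PropositionalEquality using (_≡_; refl; sym; trans; subst)

open Equivalence using (to; from)

private
  variable
    S 𝒟 : Schema
    n m : ℕ

renameTerm : (Fin n → Fin m) → Term n → Term m
renameTerm ρ (cst c) = cst c
renameTerm ρ (var x) = var (ρ x)

rename : (Fin n → Fin m) → UCQF S n → UCQF S m
rename ρ (atom R ts) = atom R (Vec.map (renameTerm ρ) ts)
rename ρ (φ ∧ ψ) = rename ρ φ ∧ rename ρ ψ
rename ρ (φ ∨ ψ) = rename ρ φ ∨ rename ρ ψ
rename ρ (∃' φ) = ∃' (rename (lift 1 ρ) φ)

IsConj-rename : (ρ : Fin n → Fin m) {φ : UCQF S n} → IsConj φ → IsConj (rename ρ φ)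
IsConj-rename ρ (atom R ts) = atom R _
IsConj-rename ρ (iφ ∧ iψ) = IsConj-rename ρ iφ ∧ IsConj-rename ρ iψ

IsCQ-rename : (ρ : Fin n → Fin m) {φ : UCQF S n} → IsCQ' φ → IsCQ' (rename ρ φ)
IsCQ-rename ρ (body iφ) = body (IsConj-rename ρ iφ)
IsCQ-rename ρ (ex iφ) = ex (IsCQ-rename (lift 1 ρ) iφ)

renameTerm-cst : ∀ {c} {ρ : Fin n → Fin m} (t : Term n) → cst c ≡ renameTerm ρ t → cst c ≡ t
renameTerm-cst (cst _) refl = refl

occursIn-rename : ∀ {c} (ρ : Fin n → Fin m) (φ : UCQF S n) → c occursIn rename ρ φ → c occursIn φ
occursIn-rename ρ (atom R ts) (inAtom c∈) = inAtom (VecAny.map (renameTerm-cst _) (VecAny.map⁻ c∈))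
occursIn-rename ρ (φ ∧ ψ) (in∧ˡ o) = in∧ˡ (occursIn-rename ρ φ o)
occursIn-rename ρ (φ ∧ ψ) (in∧ʳ o) = in∧ʳ (occursIn-rename ρ ψ o)
occursIn-rename ρ (φ ∨ ψ) (in∨ˡ o) = in∨ˡ (occursIn-rename ρ φ o)
occursIn-rename ρ (φ ∨ ψ) (in∨ʳ o) = in∨ʳ (occursIn-rename ρ ψ o)
occursIn-rename ρ (∃' φ) (in∃ o) = in∃ (occursIn-rename (lift 1 ρ) φ o)

module _ (I : Interp S) where
  open Interp I

  Sat-rename : (ρ : Fin n → Fin m) (φ : UCQF S n) (env : Vec dom m) (env' : Vec dom n) →
               (∀ i → lookup env (ρ i) ≡ lookup env' i) →
               Sat I (rename ρ φ) env ⇔ Sat I φ env'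
  Sat-rename ρ (atom R ts) env env' ρ-env = mk⇔ (subst (ext R) eval-rename) (subst (ext R) (sym eval-rename))
    where
      eval-rename : Vec.map (evalT I env) (Vec.map (renameTerm ρ) ts) ≡ Vec.map (evalT I env') ts
      eval-rename = trans (sym (Vec.map-∘ (evalT I env) (renameTerm ρ) ts))
                          (Vec.map-cong (λ { (cst c) → refl ; (var x) → ρ-env x }) ts)
  Sat-rename ρ (φ ∧ ψ) env env' ρ-env =
    mk⇔ (λ (s , t) → to φ⇔ s , to ψ⇔ t) (λ (s , t) → from φ⇔ s , from ψ⇔ t)
    where
      φ⇔ = Sat-rename ρ φ env env' ρ-env
      ψ⇔ = Sat-rename ρ ψ env env' ρ-env
  Sat-rename ρ (φ ∨ ψ) env env' ρ-env =
    mk⇔ [ inj₁ ∘ to φ⇔ , inj₂ ∘ to ψ⇔ ]′ [ inj₁ ∘ from φ⇔ , inj₂ ∘ from ψ⇔ ]′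
    where
      φ⇔ = Sat-rename ρ φ env env' ρ-env
      ψ⇔ = Sat-rename ρ ψ env env' ρ-env
  Sat-rename ρ (∃' φ) env env' ρ-env =
    mk⇔ (λ (a , s) → a , to (φ⇔ a) s) (λ (a , s) → a , from (φ⇔ a) s)
    where
      lift-env : ∀ a i → lookup (a ∷ env) (lift 1 ρ i) ≡ lookup (a ∷ env') i
      lift-env a zero = refl
      lift-env a (suc i) = ρ-env i
      φ⇔ : ∀ a → Sat I (rename (lift 1 ρ) φ) (a ∷ env) ⇔ Sat I φ (a ∷ env')
      φ⇔ a = Sat-rename (lift 1 ρ) φ (a ∷ env) (a ∷ env') (lift-env a)

  Sat-weaken : (φ : UCQF S n) (a : dom) (env : Vec dom n) → Sat I (rename suc φ) (a ∷ env) ⇔ Sat I φ env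
  Sat-weaken φ a env = Sat-rename suc φ (a ∷ env) env (λ _ → refl)

CQ : Schema → ℕ → Set
CQ S n = Σ (UCQF S n) IsCQ'

∃ᶜ : CQ S (suc n) → CQ S n
∃ᶜ (φ , iφ) = ∃' φ , ex iφ

prenex-∧-conj : {β ψ : UCQF S n} → IsConj β → IsCQ' ψ → CQ S n
prenex-∧-conj {β = β} {ψ} iβ (body iψ) = β ∧ ψ , body (iβ ∧ iψ)
prenex-∧-conj iβ (ex iψ) = ∃ᶜ (prenex-∧-conj (IsConj-rename suc iβ) iψ)

prenex-∧ : {φ ψ : UCQF S n} → IsCQ' φ → IsCQ' ψ → CQ S n
prenex-∧ (body iφ) iψ = prenex-∧-conj iφ iψ
prenex-∧ (ex iφ) iψ = ∃ᶜ (prenex-∧ iφ (IsCQ-rename suc iψ))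

_∧ᶜ_ : CQ S n → CQ S n → CQ S n
(_ , iφ) ∧ᶜ (_ , iψ) = prenex-∧ iφ iψ

occursIn-prenex-∧-conj : ∀ {c} {β ψ : UCQF S n} (iβ : IsConj β) (iψ : IsCQ' ψ) →
                         c occursIn proj₁ (prenex-∧-conj iβ iψ) → c occursIn β ⊎ c occursIn ψ
occursIn-prenex-∧-conj iβ (body iψ) (in∧ˡ o) = inj₁ o
occursIn-prenex-∧-conj iβ (body iψ) (in∧ʳ o) = inj₂ o
occursIn-prenex-∧-conj {β = β} iβ (ex iψ) (in∃ o) with occursIn-prenex-∧-conj (IsConj-rename suc iβ) iψ o
... | inj₁ o' = inj₁ (occursIn-rename suc β o')
... | inj₂ o' = inj₂ (in∃ o')

occursIn-prenex-∧ : ∀ {c} {φ ψ : UCQF S n} (iφ : IsCQ' φ) (iψ : IsCQ' ψ) →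
                    c occursIn proj₁ (prenex-∧ iφ iψ) → c occursIn φ ⊎ c occursIn ψ
occursIn-prenex-∧ (body iφ) iψ o = occursIn-prenex-∧-conj iφ iψ o
occursIn-prenex-∧ {ψ = ψ} (ex iφ) iψ (in∃ o) with occursIn-prenex-∧ iφ (IsCQ-rename suc iψ) o
... | inj₁ o' = inj₁ (in∃ o')
... | inj₂ o' = inj₂ (occursIn-rename suc ψ o')

module _ (I : Interp S) where
  open Interp I

  Sat-prenex-∧-conj : {β ψ : UCQF S n} (iβ : IsConj β) (iψ : IsCQ' ψ) (env : Vec dom n) →
                      Sat I (proj₁ (prenex-∧-conj iβ iψ)) env ⇔ (Sat I β env × Sat I ψ env)
  Sat-prenex-∧-conj iβ (body iψ) env = mk⇔ (λ s → s) (λ s → s)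
  Sat-prenex-∧-conj {β = β} iβ (ex iψ) env =
    mk⇔ (λ (a , s) → let (t , u) = to (IH a) s in to (Sat-weaken I β a env) t , a , u)
        (λ (t , a , u) → a , from (IH a) (from (Sat-weaken I β a env) t , u))
    where
      IH = λ a → Sat-prenex-∧-conj (IsConj-rename suc iβ) iψ (a ∷ env)

  Sat-prenex-∧ : {φ ψ : UCQF S n} (iφ : IsCQ' φ) (iψ : IsCQ' ψ) (env : Vec dom n) →
                 Sat I (proj₁ (prenex-∧ iφ iψ)) env ⇔ (Sat I φ env × Sat I ψ env)
  Sat-prenex-∧ (body iφ) iψ env = Sat-prenex-∧-conj iφ iψ env
  Sat-prenex-∧ {ψ = ψ} (ex iφ) iψ env =
    mk⇔ (λ (a , s) → let (t , u) = to (IH a) s in (a , t) , to (Sat-weaken I ψ a env) u)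
        (λ ((a , t) , u) → a , from (IH a) (t , from (Sat-weaken I ψ a env) u))
    where
      IH = λ a → Sat-prenex-∧ iφ (IsCQ-rename suc iψ) (a ∷ env)

disjuncts : UCQF S n → List (CQ S n)
disjuncts (atom R ts) = [ atom R ts , body (atom R ts) ]
disjuncts (φ ∧ ψ) = cartesianProductWith _∧ᶜ_ (disjuncts φ) (disjuncts ψ)
disjuncts (φ ∨ ψ) = disjuncts φ ++ disjuncts ψ
disjuncts (∃' φ) = map ∃ᶜ (disjuncts φ)

some-disjunct : (φ : UCQF S n) → ∃ λ c → c ∈ disjuncts φ
some-disjunct (atom R ts) = _ , here refl
some-disjunct (φ ∧ ψ) with c , c∈ ← some-disjunct φ | d , d∈ ← some-disjunct ψ =
  c ∧ᶜ d , ∈-cartesianProductWith⁺ _∧ᶜ_ c∈ d∈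
some-disjunct (φ ∨ ψ) with c , c∈ ← some-disjunct φ = c , ∈-++⁺ˡ c∈
some-disjunct (∃' φ) with c , c∈ ← some-disjunct φ = ∃ᶜ c , ∈-map⁺ ∃ᶜ c∈

occursIn-disjunct : ∀ {x} (φ : UCQF S n) {c} → c ∈ disjuncts φ → x occursIn proj₁ c → x occursIn φ
occursIn-disjunct (atom R ts) (here refl) o = o
occursIn-disjunct (φ ∧ ψ) c∈ o
  with (_ , iφ) , (_ , iψ) , φ∈ , ψ∈ , refl ← ∈-cartesianProductWith⁻ _∧ᶜ_ (disjuncts φ) (disjuncts ψ) c∈
  with occursIn-prenex-∧ iφ iψ o
... | inj₁ o' = in∧ˡ (occursIn-disjunct φ φ∈ o')
... | inj₂ o' = in∧ʳ (occursIn-disjunct ψ ψ∈ o')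
occursIn-disjunct (φ ∨ ψ) c∈ o with ∈-++⁻ (disjuncts φ) c∈
... | inj₁ c∈φ = in∨ˡ (occursIn-disjunct φ c∈φ o)
... | inj₂ c∈ψ = in∨ʳ (occursIn-disjunct ψ c∈ψ o)
occursIn-disjunct (∃' φ) c∈ o with ∈-map⁻ ∃ᶜ c∈
occursIn-disjunct (∃' φ) _ (in∃ o) | _ , c∈φ , refl = in∃ (occursIn-disjunct φ c∈φ o)

module _ (I : Interp S) where
  open Interp I

  disjunct-sound : (φ : UCQF S n) {c : CQ S n} → c ∈ disjuncts φ →
                   (env : Vec dom n) → Sat I (proj₁ c) env → Sat I φ env
  disjunct-sound (atom R ts) (here refl) env s = s
  disjunct-sound (φ ∧ ψ) c∈ env s
    with (_ , iφ) , (_ , iψ) , φ∈ , ψ∈ , refl ← ∈-cartesianProductWith⁻ _∧ᶜ_ (disjuncts φ) (disjuncts ψ) c∈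
    with t , u ← to (Sat-prenex-∧ I iφ iψ env) s =
    disjunct-sound φ φ∈ env t , disjunct-sound ψ ψ∈ env u
  disjunct-sound (φ ∨ ψ) c∈ env s with ∈-++⁻ (disjuncts φ) c∈
  ... | inj₁ c∈φ = inj₁ (disjunct-sound φ c∈φ env s)
  ... | inj₂ c∈ψ = inj₂ (disjunct-sound ψ c∈ψ env s)
  disjunct-sound (∃' φ) c∈ env s with ∈-map⁻ ∃ᶜ c∈
  disjunct-sound (∃' φ) _ env (a , s) | _ , c∈φ , refl = a , disjunct-sound φ c∈φ (a ∷ env) s

  disjunct-complete : (φ : UCQF S n) (env : Vec dom n) → Sat I φ env →
                      ∃ λ c → c ∈ disjuncts φ × Sat I (proj₁ c) env
  disjunct-complete (atom R ts) env s = _ , here refl , s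
  disjunct-complete (φ ∧ ψ) env (s , t)
    with c , c∈ , sc ← disjunct-complete φ env s | d , d∈ , sd ← disjunct-complete ψ env t =
    c ∧ᶜ d , ∈-cartesianProductWith⁺ _∧ᶜ_ c∈ d∈ , from (Sat-prenex-∧ I (proj₂ c) (proj₂ d) env) (sc , sd)
  disjunct-complete (φ ∨ ψ) env (inj₁ s) with c , c∈ , sc ← disjunct-complete φ env s =
    c , ∈-++⁺ˡ c∈ , sc
  disjunct-complete (φ ∨ ψ) env (inj₂ s) with c , c∈ , sc ← disjunct-complete ψ env s =
    c , ∈-++⁺ʳ (disjuncts φ) c∈ , sc
  disjunct-complete (∃' φ) env (a , s) with c , c∈ , sc ← disjunct-complete φ (a ∷ env) s =
    ∃ᶜ c , ∈-map⁺ ∃ᶜ c∈ , a , sc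

disjunction : UCQF S n → List (UCQF S n) → UCQF S n
disjunction = foldr _∨_

Sat-disjunction : (I : Interp S) {φ₀ ψ : UCQF S n} {ψs : List (UCQF S n)} {env : Vec (Interp.dom I) n} →
                  ψ ∈ ψs → Sat I ψ env → Sat I (disjunction φ₀ ψs) env
Sat-disjunction I (here refl) s = inj₁ s
Sat-disjunction I (there ψ∈) s = inj₂ (Sat-disjunction I ψ∈ s)

occursIn-disjunction : ∀ {x} (φ₀ : UCQF S n) (ψs : List (UCQF S n)) → x occursIn disjunction φ₀ ψs →
                       x occursIn φ₀ ⊎ ∃ λ ψ → ψ ∈ ψs × x occursIn ψ
occursIn-disjunction φ₀ [] o = inj₁ o
occursIn-disjunction φ₀ (ψ ∷ ψs) (in∨ˡ o) = inj₂ (ψ , here refl , o)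
occursIn-disjunction φ₀ (ψ ∷ ψs) (in∨ʳ o) with occursIn-disjunction φ₀ ψs o
... | inj₁ o₀ = inj₁ o₀
... | inj₂ (ψ' , ψ'∈ , o') = inj₂ (ψ' , there ψ'∈ , o')

constructive-disjunction : {O : OntRel 𝒟 S} → QueryConstructive O → ∀ D (φ₀ : BUCQ S) ψs →
                           O D (disjunction φ₀ ψs) → O D φ₀ ⊎ ∃ λ ψ → ψ ∈ ψs × O D ψ
constructive-disjunction qc D φ₀ [] o = inj₁ o
constructive-disjunction qc D φ₀ (ψ ∷ ψs) o with qc D ψ (disjunction φ₀ ψs) o
... | inj₁ oψ = inj₂ (ψ , here refl , oψ)
... | inj₂ o' with constructive-disjunction qc D φ₀ ψs o'
...   | inj₁ o₀ = inj₁ o₀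
...   | inj₂ (ψ' , ψ'∈ , oψ') = inj₂ (ψ' , there ψ'∈ , oψ')

module _ {O : OntRel 𝒟 S} (isO : IsOntology 𝒟 S O) (qc : QueryConstructive O) where
  open IsOntology isO

  disjunct-∈-ontology : ∀ D q → O D q → ∃ λ c → c ∈ disjuncts q × O D (proj₁ c)
  disjunct-∈-ontology D q o = [ (λ o₀ → c₀ , c₀∈ , o₀) , in-disjuncts ]′ (constructive-disjunction qc D _ _ o-Q)
    where
      -- The seed c₀ of the fold is itself a disjunct, so no empty disjunction is needed.
      c₀ = proj₁ (some-disjunct q)
      c₀∈ = proj₂ (some-disjunct q)
      ψs = map proj₁ (disjuncts q)
      Q = disjunction (proj₁ c₀) ψs

      q⊨Q : q ⊨ Q
      q⊨Q I s with c , c∈ , sc ← disjunct-complete I q Vec.[] s = Sat-disjunction I (∈-map⁺ proj₁ c∈) sc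

      consts-Q : ConstsIn Q D
      consts-Q x ox with occursIn-disjunction (proj₁ c₀) ψs ox
      ... | inj₁ o₀ = proj₂ (wf D q o) x (occursIn-disjunct q c₀∈ o₀)
      ... | inj₂ (ψ , ψ∈ , oψ) with c , c∈ , refl ← ∈-map⁻ proj₁ ψ∈ = proj₂ (wf D q o) x (occursIn-disjunct q c∈ oψ)

      o-Q : O D Q
      o-Q = entail D q Q q⊨Q consts-Q o

      in-disjuncts : (∃ λ ψ → ψ ∈ ψs × O D ψ) → ∃ λ c → c ∈ disjuncts q × O D (proj₁ c)
      in-disjuncts (ψ , ψ∈ , oψ) with c , c∈ , refl ← ∈-map⁻ proj₁ ψ∈ = c , c∈ , oψ

cq-inclusion⇒inclusion : {O O' : OntRel 𝒟 S} → IsOntology 𝒟 S O → IsOntology 𝒟 S O' → QueryConstructive O →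
                         (∀ D q → IsCQ q → O D q → O' D q) → ∀ D q → O D q → O' D q
cq-inclusion⇒inclusion isO isO' qc O⊆O' D q o with c , c∈ , oc ← disjunct-∈-ontology isO qc D q o =
  IsOntology.entail isO' D (proj₁ c) q (λ I → disjunct-sound I q c∈ Vec.[])
    (proj₂ (IsOntology.wf isO D q o)) (O⊆O' D (proj₁ c) (proj₂ c) oc)

lemma4 : (𝒟 𝒬 : Schema) (O O' : OntRel 𝒟 𝒬) →
    IsOntology 𝒟 𝒬 O → IsOntology 𝒟 𝒬 O' →
    QueryConstructive O → QueryConstructive O' →
    SameCQRestriction O O' →
    SameOntology O O'
lemma4 𝒟 𝒬 O O' isO isO' qc qc' same D q =
  cq-inclusion⇒inclusion isO isO' qc (λ D q isCQ → proj₁ (same D q isCQ)) D q ,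
  cq-inclusion⇒inclusion isO' isO qc' (λ D q isCQ → proj₂ (same D q isCQ)) D q
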